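{- Let $G$ be a graph on vertex set $V=\{1,\ldots,n\}$ and let $x,y\in V$ with $x<y$. If $xy\in E(KO(G))$, then $ij\in E(KO(G))$ for every pair of integers $i,j$ with $1\leq i\leq x$ and $i<j\leq y$.
   Context: For a graph $G$ and vertices $u,v$, the Kelmans operation from $v$ to $u$ produces the graph $KO_{uv}(G)$ obtained from $G$ by replacing the edge $vw$ with a new edge $uw$ for every $w\in N_G(v)\setminus(N_G(u)\cup\{u\})$. For a graph $G$ on vertex set $\{1,\dots,n\}$, $KO(G)$ denotes the graph obtained from $G$ by applying Kelmans operations $KO_{uv}$ (from $v$ to $u$) to vertex pairs $(u,v)$ with $u<v$, in such a way that the result is stable: $KO_{uv}(KO(G))=KO(G)$ for every pair $u<v$. -}

module Defs where

open import Data.Nat using (ℕ)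
open import Data.Bool using (Bool; true; false; _∧_; not; if_then_else_)
open import Data.Fin using (Fin; _<_)
open import Data.Fin.Properties using (_≟_)
open import Relation.Nullary.Decidable using (⌊_⌋)
open import Relation.Binary.PropositionalEquality using (_≡_)

-- A graph on vertex set {1,…,n}, encoded 0-indexed as Fin n,
-- given by its adjacency function.
Graph : ℕ → Set
Graph n = Fin n → Fin n → Bool

record IsSimple {n : ℕ} (G : Graph n) : Set where
  field
    symmetric   : ∀ a b → G a b ≡ G b a
    irreflexive : ∀ a → G a a ≡ false

_==_ : {n : ℕ} → Fin n → Fin n → Bool
a == b = ⌊ a ≟ b ⌋

moved : {n : ℕ} → Graph n → Fin n → Fin n → Fin n → Bool
moved G u v w = G v w ∧ not (G u w) ∧ not (w == u)

-- Kelmans operation from v to u: replace vw by uw for every moved w.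
KO : {n : ℕ} → Fin n → Fin n → Graph n → Graph n
KO u v G a b =
  if (a == v) ∧ moved G u v b then false
  else if (b == v) ∧ moved G u v a then false
  else if (a == u) ∧ moved G u v b then true
  else if (b == u) ∧ moved G u v a then true
  else G a b

data KOReach {n : ℕ} (G : Graph n) : Graph n → Set where
  done : KOReach G G
  step : ∀ {H} (u v : Fin n) → u < v → KOReach G H → KOReach G (KO u v H)

Stable : {n : ℕ} → Graph n → Set
Stable {n} H = ∀ (u v : Fin n) → u < v → ∀ a b → KO u v H a b ≡ H a b

-- A stable graph is "shifted": whenever v ~ w and u < v with w ≠ u, also u ~ w,
-- since otherwise KO_{uv} would move the edge vw to uw. Starting from the edge xy,
-- shifting the left end from x down to i and then the right end from y down to j
-- (using symmetry, which every Kelmans operation preserves) gives the edge ij.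
module Submission where

open import Defs
open import Data.Nat using (ℕ)
open import Data.Bool using (Bool; true; false; _∧_; if_then_else_)
open import Data.Fin using (Fin; _<_; _≤_)
open import Data.Bool.Properties using (not-¬)
open import Data.Fin.Properties using (_≟_; <⇒≢; ≤∧≢⇒<)
open import Data.Nat.Properties using (<-≤-trans)
open import Relation.Nullary using (yes; no; contradiction)
open import Relation.Nullary.Decidable using (isYes≗does; dec-true; dec-false)
open import Relation.Binary.PropositionalEquality using (_≡_; _≢_; refl; sym; trans)

IsSymmetric : {n : ℕ} → Graph n → Set
IsSymmetric {n} H = ∀ (a b : Fin n) → H a b ≡ H b a

-- The four guards of KO u v H a b become those of KO u v H b a, pairwise swapped.
if-guards-swap : ∀ (P Q R S x y : Bool) → x ≡ y →
  (if P then false else if Q then false else if R then true else if S then true else x)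
  ≡ (if Q then false else if P then false else if S then true else if R then true else y)
if-guards-swap true  true  R     S     x y _ = refl
if-guards-swap true  false R     S     x y _ = refl
if-guards-swap false true  R     S     x y _ = refl
if-guards-swap false false true  true  x y _ = refl
if-guards-swap false false true  false x y _ = refl
if-guards-swap false false false true  x y _ = refl
if-guards-swap false false false false x y x≡y = x≡y

KO-symmetric : {n : ℕ} (u v : Fin n) (H : Graph n) → IsSymmetric H → IsSymmetric (KO u v H)
KO-symmetric u v H symH a b =
  if-guards-swap ((a == v) ∧ moved H u v b) ((b == v) ∧ moved H u v a)
                 ((a == u) ∧ moved H u v b) ((b == u) ∧ moved H u v a)
                 (H a b) (H b a) (symH a b)

KOReach-symmetric : {n : ℕ} {G H : Graph n} → IsSimple G → KOReach G H → IsSymmetric H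
KOReach-symmetric simpleG done                 = IsSimple.symmetric simpleG
KOReach-symmetric simpleG (step {H} u v _ G⇝H) = KO-symmetric u v H (KOReach-symmetric simpleG G⇝H)

==-refl : {n : ℕ} (a : Fin n) → (a == a) ≡ true
==-refl a = trans (isYes≗does (a ≟ a)) (dec-true (a ≟ a) refl)

==-≢ : {n : ℕ} {a b : Fin n} → a ≢ b → (a == b) ≡ false
==-≢ {a = a} {b} a≢b = trans (isYes≗does (a ≟ b)) (dec-false (a ≟ b) a≢b)

moved-intro : {n : ℕ} (H : Graph n) {u v w : Fin n} →
  H v w ≡ true → H u w ≡ false → w ≢ u → moved H u v w ≡ true
moved-intro H vw uw w≢u rewrite vw | uw | ==-≢ w≢u = refl

KO-removes-moved : {n : ℕ} (H : Graph n) (u v w : Fin n) →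
  moved H u v w ≡ true → KO u v H v w ≡ false
KO-removes-moved H u v w isMoved rewrite ==-refl v | isMoved = refl

Stable⇒shift-neighbour : {n : ℕ} {H : Graph n} → Stable H → {u v w : Fin n} →
  u < v → H v w ≡ true → w ≢ u → H u w ≡ true
Stable⇒shift-neighbour {H = H} stable {u} {v} {w} u<v vw w≢u with H u w in uw
... | true  = refl
... | false = contradiction
  (trans (sym (stable u v u<v v w)) (KO-removes-moved H u v w (moved-intro H vw uw w≢u)))
  (not-¬ vw)

Stable⇒shift-neighbour≤ : {n : ℕ} {H : Graph n} → Stable H → {u v w : Fin n} →
  u ≤ v → H v w ≡ true → w ≢ u → H u w ≡ true
Stable⇒shift-neighbour≤ stable {u} {v} u≤v vw w≢u with u ≟ v
... | yes refl = vw
... | no  u≢v  = Stable⇒shift-neighbour stable (≤∧≢⇒< u≤v u≢v) vw w≢u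

proposition2p3 : (n : ℕ) (G : Graph n) → IsSimple G →
    (H : Graph n) → KOReach G H → Stable H →
    (x y : Fin n) → x < y → H x y ≡ true →
    (i j : Fin n) → i ≤ x → i < j → j ≤ y → H i j ≡ true
proposition2p3 _ _ simpleG H G⇝H stable x y _ xy i j i≤x i<j j≤y =
  trans (symH i j) (Stable⇒shift-neighbour≤ stable j≤y (trans (symH y i) iy) (<⇒≢ i<j))
  where
  symH : IsSymmetric H
  symH = KOReach-symmetric simpleG G⇝H

  iy : H i y ≡ true
  iy = Stable⇒shift-neighbour≤ stable i≤x xy (λ y≡i → <⇒≢ (<-≤-trans i<j j≤y) (sym y≡i))
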